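{- Let $d\geq3$, let $G$ be a $d$-angulation whose external face has $d$ distinct vertices $u_1,\dots,u_d$ in clockwise order, and let $L$ be a clockwise labelling of $G$. For each vertex $v$ of $G$, the sum of the clockwise-jumps of $L$ over all arcs with origin $v$ equals $d$ if $v$ is internal and $0$ if $v$ is external. For each internal edge $e=\{u,v\}$, the sum of the clockwise-jumps across the two arcs $(u,e)$ and $(v,e)$ equals $d-2$.
   Context: Graphs are finite, loopless, possibly with multiple edges. A plane graph is a connected planar graph with a fixed crossing-free drawing; the unbounded face is external; vertices/edges incident to it are external, others internal. An edge $e=\{u,v\}$ has two arcs $(u,e)$ and $(v,e)$, with origins $u$ and $v$. A corner is a pair of consecutive edges around a vertex; the degree of a face is its number of corners. A $d$-angulation is a plane graph all of whose faces have degree $d$. Clockwise order around an internal face: walk along its contour with the face on the right; around the external face: with the external face on the left. $[d]=\{1,\dots,d\}$ with arithmetic modulo $d$. A clockwise labelling of $G$ assigns a color in $[d]$ to each corner such that: (i) consecutive corners in clockwise order around any face have colors $c$ and $c+1$ (mod $d$); (ii) all corners incident to $u_i$ have color $i$; (iii) in clockwise order around each internal vertex exactly one corner has larger color (as an integer in $\{1,\dots,d\}$) than the next corner. For an arc $a=(u,e)$, the clockwise-jump across $a$ is the element of $\{0,\dots,d-1\}$ congruent to $\ell_2-\ell_1$ modulo $d$, where $\ell_1,\ell_2$ are the colors of the corners preceding and following $e$ in clockwise order around $u$. -}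

module Defs where

open import Data.Nat using (ℕ; zero; suc; _+_; _*_; _∸_; _≤_; _≤ᵇ_; _<ᵇ_)
open import Data.Fin using (Fin; toℕ; _≟_)
open import Data.Fin.Permutation using (Permutation′; _⟨$⟩ʳ_; _⟨$⟩ˡ_)
open import Data.List using (List; map; allFin)
open import Data.Nat.ListAction using (sum)
open import Data.Bool using (Bool; if_then_else_; _∧_)
open import Data.Product using (Σ; Σ-syntax; ∃; ∃-syntax; _×_; _,_)
open import Data.Sum using (_⊎_)
open import Relation.Nullary using (¬_; does)
open import Relation.Binary.PropositionalEquality using (_≡_; _≢_)
open import Function.Bundles using (_⇔_)

iter : {A : Set} → (A → A) → ℕ → A → A
iter f zero    x = x
iter f (suc k) x = f (iter f k x)

SameOrbit : {A : Set} → (A → A) → A → A → Set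
SameOrbit f x y = ∃[ k ] iter f k x ≡ y

sumWhere : {n : ℕ} → (Fin n → Bool) → (Fin n → ℕ) → ℕ
sumWhere {n} p f = sum (map (λ x → if p x then f x else 0) (allFin n))

countWhere : {n : ℕ} → (Fin n → Bool) → ℕ
countWhere p = sumWhere p (λ _ → 1)

data Reach {A : Set} (f g : A → A) : A → A → Set where
  here  : ∀ {x} → Reach f g x x
  stepf : ∀ {x y} → Reach f g (f x) y → Reach f g x y
  stepg : ∀ {x y} → Reach f g (g x) y → Reach f g x y

-- Plane graphs as combinatorial maps (rotation systems) of genus 0.
--
-- Arcs (darts) are Fin (2 * E).  α pairs the two arcs of each edge;
-- σ sends an arc to the next arc clockwise around its origin.
-- Vertices are the σ-orbits (classified by vert : arcs → Fin V),
-- faces are the orbits of ψ = α ∘ σ (classified by face : arcs → Fin F).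
-- The corner "c(x)" associated with arc x is the corner between x and
-- σ x (the corner following x clockwise around its origin); it lies in
-- face (face x).  Walking along a face with the face on the right, the
-- corner following c(x) is c(σ⁻¹ (α x)), i.e. c(x) is followed by c(y)
-- exactly when x = α (σ y).

record PlaneGraph : Set₁ where
  field
    E V F  : ℕ
    α      : Permutation′ (2 * E)
    σ      : Permutation′ (2 * E)
    vert   : Fin (2 * E) → Fin V
    face   : Fin (2 * E) → Fin F
    outer  : Fin F
  Arc : Set
  Arc = Fin (2 * E)
  αf : Arc → Arc
  αf x = α ⟨$⟩ʳ x
  σf : Arc → Arc
  σf x = σ ⟨$⟩ʳ x
  σ⁻¹ : Arc → Arc
  σ⁻¹ x = σ ⟨$⟩ˡ x
  ψ : Arc → Arc
  ψ x = αf (σf x)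
  field
    α-invol    : ∀ x → αf (αf x) ≡ x
    α-noFix    : ∀ x → αf x ≢ x
    vert-surj  : ∀ v → ∃[ x ] vert x ≡ v
    vert-orbit : ∀ x y → (vert x ≡ vert y) ⇔ SameOrbit σf x y
    face-surj  : ∀ f → ∃[ x ] face x ≡ f
    face-orbit : ∀ x y → (face x ≡ face y) ⇔ SameOrbit ψ x y
    loopless   : ∀ x → vert (αf x) ≢ vert x
    -- connectedness: the group generated by α and σ acts transitively
    connected  : ∀ x y → Reach αf σf x y
    -- genus 0 (Euler's formula): the map is a plane (spherical) embedding
    euler      : V + F ≡ E + 2

  atVertex : Fin V → Arc → Bool
  atVertex v x = does (vert x ≟ v)

  inFace : Fin F → Arc → Bool
  inFace f x = does (face x ≟ f)

  degree : Fin F → ℕ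
  degree f = countWhere (inFace f)

  External : Fin V → Set
  External v = ∃[ x ] vert x ≡ v × face x ≡ outer

  Internal : Fin V → Set
  Internal v = ¬ External v

  -- the edge {x, α x} borders the faces face x and face (α x)
  -- (the corners following x and preceding x around its origin)
  InternalEdge : Arc → Set
  InternalEdge x = face x ≢ outer × face (αf x) ≢ outer

open PlaneGraph public

IsAngulation : ℕ → PlaneGraph → Set
IsAngulation d G = ∀ f → degree G f ≡ d

-- The external face has d distinct vertices u₁ … u_d in clockwise order
-- (clockwise around the external face = with the external face on the left,
-- i.e. c(x) is followed by c(α (σ x))).  Colour/index k : Fin d stands for k+1.
sucMod : {d : ℕ} → Fin d → Fin d → Set
sucMod {d} a b = (suc (toℕ a) ≡ toℕ b) ⊎ (suc (toℕ a) ≡ d × toℕ b ≡ 0)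

ExternalCycle : (d : ℕ) (G : PlaneGraph) → (Fin d → Fin (V G)) → Set
ExternalCycle d G u =
  (∀ i j → u i ≡ u j → i ≡ j) ×
  (Σ[ x ∈ (Fin d → Arc G) ] ((∀ i → vert G (x i) ≡ u i × face G (x i) ≡ outer G) ×
           (∀ i j → sucMod {d} i j → αf G (σf G (x i)) ≡ x j)))

-- clockwise labellings: a colour L x ∈ Fin d for the corner c(x)
IsClockwiseLabelling : (d : ℕ) (G : PlaneGraph) (u : Fin d → Fin (V G))
                       (L : Arc G → Fin d) → Set
IsClockwiseLabelling d G u L =
  -- (i) consecutive corners clockwise around any face: c then c+1.
  --     internal face: c(α(σ y)) followed by c(y)
  (∀ y → face G y ≢ outer G → sucMod {d} (L (αf G (σf G y))) (L y)) ×
  --     external face: c(y) followed by c(α(σ y))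
  (∀ y → face G y ≡ outer G → sucMod {d} (L y) (L (αf G (σf G y)))) ×
  (∀ i y → vert G y ≡ u i → L y ≡ i) ×
  (∀ v → Internal G v →
     countWhere (λ y → atVertex G v y ∧ (toℕ (L (σf G y)) <ᵇ toℕ (L y))) ≡ 1)

-- representative in {0,…,d-1} of ℓ₂ - ℓ₁ mod d
jumpMod : (d : ℕ) → Fin d → Fin d → ℕ
jumpMod d l₁ l₂ = if toℕ l₁ ≤ᵇ toℕ l₂ then toℕ l₂ ∸ toℕ l₁
                  else d + toℕ l₂ ∸ toℕ l₁

-- clockwise-jump across arc x: preceding corner is c(σ⁻¹ x), following is c(x)
jump : (d : ℕ) (G : PlaneGraph) (L : Arc G → Fin d) → Arc G → ℕ
jump d G L x = jumpMod d (L (σ⁻¹ G x)) (L x)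

module Submission where

-- Write jump x for the clockwise-jump across the arc x and s = d - 2.
-- (1) Vertices.  For every labelling, jump x + L(σ⁻¹ x) = L x + d·[L x < L(σ⁻¹ x)].
--     Summed over the arcs at a vertex v the colours telescope (σ permutes
--     these arcs), so the jumps at v sum to d times the number of descents
--     at v.  Internal vertices have one descent by rule (iii); the external
--     vertices are exactly the uᵢ (the external face is the ψ-cycle of the
--     arcs xᵢ), all of whose corners have colour i, so they have none.
-- (2) Edges.  Rule (i) on the two faces beside an internal edge gives
--     jump x + jump (α x) + 2 ≡ 0 (mod d); since jumps are < d, the two
--     jumps sum to s or are both d - 1.
-- (3) Double counting excludes the second case.  By (1) the jumps total
--     d·(V - d); with F·d = 2E and Euler's formula, 2·∑ jump + 2d·s = 2E·s.
--     Every arc contributes at least s to the left-hand side (its edge is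
--     internal, or it pays through a correction term along the external
--     face), while an arc whose edge has both jumps d - 1 contributes s + d.

open import Defs
open import Data.Nat using (ℕ; zero; suc; _≤_; _<_; _∸_; _+_; _*_; z≤n; s≤s; s≤s⁻¹; _≤ᵇ_; _<ᵇ_)
open import Data.Nat.Properties hiding (_≟_)
open import Data.Fin using (Fin; zero; suc; toℕ; _≟_)
open import Data.Fin.Properties using (toℕ<n; any?)
open import Data.Fin.Permutation using (inverseˡ; inverseʳ)
open import Data.List using (tabulate; _∷_; [])
open import Data.List.Properties using (map-tabulate)
open import Data.Nat.ListAction using (sum)
open import Data.Bool using (Bool; true; false; if_then_else_; _∧_)
open import Data.Product using (∃-syntax; _×_; _,_; proj₁; proj₂)
open import Data.Sum using (_⊎_; inj₁; inj₂)
open import Function using (id; _∘_)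
open import Function.Bundles using (Equivalence)
open import Relation.Nullary using (¬_; yes; no; does; contradiction)
open import Relation.Nullary.Reflects using (ofʸ; ofⁿ)
open import Relation.Binary.PropositionalEquality
  using (_≡_; _≢_; refl; sym; trans; cong; cong₂; subst; module ≡-Reasoning)
open import Data.Nat.Tactic.RingSolver using (solve; solve-∀)
open import Algebra.Properties.Semiring.Sum +-*-semiring
  using (sum-syntax; sum-cong-≗; sum-replicate-zero; ∑-permute; ∑-comm; ∑-distrib-+; *-distribˡ-sum)

guard : Bool → ℕ → ℕ
guard b n = if b then n else 0

guard-scale : ∀ b n → guard b n ≡ guard b 1 * n
guard-scale true  n = sym (+-identityʳ n)
guard-scale false n = refl

guard-guard : ∀ b c n → guard b (guard c n) ≡ n * guard (b ∧ c) 1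
guard-guard true  true  n = sym (*-identityʳ n)
guard-guard true  false n = sym (*-zeroʳ n)
guard-guard false c     n = sym (*-zeroʳ n)

listSum-tabulate : ∀ {n} (f : Fin n → ℕ) → sum (tabulate f) ≡ ∑[ i < n ] f i
listSum-tabulate {zero}  f = refl
listSum-tabulate {suc n} f = cong (f zero +_) (listSum-tabulate (f ∘ suc))

sumWhere-∑ : ∀ {n} (p : Fin n → Bool) (f : Fin n → ℕ) →
             sumWhere p f ≡ ∑[ x < n ] guard (p x) (f x)
sumWhere-∑ {n} p f = trans (cong sum (map-tabulate id term)) (listSum-tabulate term)
  where
    term : Fin n → ℕ
    term x = guard (p x) (f x)

∑-const : ∀ n c → ∑[ i < n ] c ≡ n * c
∑-const zero    c = refl
∑-const (suc n) c = cong (c +_) (∑-const n c)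

∑-zero : ∀ {n} {f : Fin n → ℕ} → (∀ i → f i ≡ 0) → ∑[ i < n ] f i ≡ 0
∑-zero {n} zeros = trans (sum-cong-≗ zeros) (sum-replicate-zero n)

∑-mono-≤ : ∀ {n} {f g : Fin n → ℕ} → (∀ i → f i ≤ g i) → ∑[ i < n ] f i ≤ ∑[ i < n ] g i
∑-mono-≤ {zero}  le = z≤n
∑-mono-≤ {suc n} le = +-mono-≤ (le zero) (∑-mono-≤ (le ∘ suc))

∑-δ : ∀ {n} (a : Fin n) c → ∑[ j < n ] guard (does (a ≟ j)) c ≡ c
∑-δ {suc n} zero    c = trans (cong (c +_) (∑-zero {n} λ _ → refl)) (+-identityʳ c)
∑-δ {suc n} (suc a) c = ∑-δ a c

∑-fibres : ∀ {m n} (g : Fin m → Fin n) (f : Fin m → ℕ) →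
           ∑[ x < m ] f x ≡ ∑[ j < n ] sumWhere (λ x → does (g x ≟ j)) f
∑-fibres {m} {n} g f = begin
  ∑[ x < m ] f x                                     ≡⟨ sum-cong-≗ (λ x → sym (∑-δ (g x) (f x))) ⟩
  ∑[ x < m ] ∑[ j < n ] guard (does (g x ≟ j)) (f x) ≡⟨ ∑-comm (λ x j → guard (does (g x ≟ j)) (f x)) ⟩
  ∑[ j < n ] ∑[ x < m ] guard (does (g x ≟ j)) (f x) ≡⟨ sum-cong-≗ (λ j → sym (sumWhere-∑ (λ x → does (g x ≟ j)) f)) ⟩
  ∑[ j < n ] sumWhere (λ x → does (g x ≟ j)) f       ∎
  where open ≡-Reasoning

fibre-injective : ∀ {m n} (g : Fin m → Fin n) → (∀ i j → g i ≡ g j → i ≡ j) →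
                  ∀ i → countWhere (λ j → does (g j ≟ g i)) ≡ 1
fibre-injective g inj i = trans (sumWhere-∑ (λ j → does (g j ≟ g i)) (λ _ → 1)) (trans (sum-cong-≗ same) (∑-δ i 1))
  where
    same : ∀ j → guard (does (g j ≟ g i)) 1 ≡ guard (does (i ≟ j)) 1
    same j with g j ≟ g i | i ≟ j
    ... | yes _  | yes _    = refl
    ... | no  _  | no  _    = refl
    ... | yes eq | no  i≢j  = contradiction (sym (inj j i eq)) i≢j
    ... | no  ne | yes refl = contradiction refl ne

fibre-empty : ∀ {m n} (g : Fin m → Fin n) v → ¬ (∃[ i ] g i ≡ v) →
              countWhere (λ j → does (g j ≟ v)) ≡ 0
fibre-empty g v none = trans (sumWhere-∑ (λ j → does (g j ≟ v)) (λ _ → 1)) (∑-zero empty)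
  where
    empty : ∀ j → guard (does (g j ≟ v)) 1 ≡ 0
    empty j with g j ≟ v
    ... | yes eq = contradiction (j , eq) none
    ... | no  _  = refl

∑-excess : ∀ {n c e} (f : Fin n → ℕ) (i₀ : Fin n) →
           (∀ i → c ≤ f i) → c + e ≤ f i₀ → n * c + e ≤ ∑[ i < n ] f i
∑-excess {n} {c} {e} f i₀ lower peak = begin
  n * c + e                                          ≡⟨ cong₂ _+_ (∑-const n c) (∑-δ i₀ e) ⟨
  ∑[ i < n ] c + ∑[ i < n ] guard (does (i₀ ≟ i)) e ≡⟨ ∑-distrib-+ (λ _ → c) (λ i → guard (does (i₀ ≟ i)) e) ⟨
  ∑[ i < n ] (c + guard (does (i₀ ≟ i)) e)           ≤⟨ ∑-mono-≤ bound ⟩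
  ∑[ i < n ] f i                                     ∎
  where
    open ≤-Reasoning
    bound : ∀ i → c + guard (does (i₀ ≟ i)) e ≤ f i
    bound i with i₀ ≟ i
    ... | yes refl = peak
    ... | no  _    = ≤-trans (≤-reflexive (+-identityʳ c)) (lower i)

infix 4 _≽_[mod_]
_≽_[mod_] : ℕ → ℕ → ℕ → Set
m ≽ n [mod d ] = ∃[ w ] m ≡ n + w * d

≽-+ : ∀ {d m n m′ n′} → m ≽ n [mod d ] → m′ ≽ n′ [mod d ] → m + m′ ≽ n + n′ [mod d ]
≽-+ {d} {m} {n} {m′} {n′} (w , m≡) (w′ , m′≡) = w + w′ , (begin
  m + m′                    ≡⟨ cong₂ _+_ m≡ m′≡ ⟩
  n + w * d + (n′ + w′ * d) ≡⟨ solve (d ∷ n ∷ n′ ∷ w ∷ w′ ∷ []) ⟩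
  n + n′ + (w + w′) * d     ∎)
  where open ≡-Reasoning

≽-cancelʳ : ∀ {d m n} c → m + c ≽ n + c [mod d ] → m ≽ n [mod d ]
≽-cancelʳ {d} {m} {n} c (w , eq) = w , +-cancelʳ-≡ c m (n + w * d) (begin
  m + c         ≡⟨ eq ⟩
  n + c + w * d ≡⟨ solve (d ∷ n ∷ c ∷ w ∷ []) ⟩
  n + w * d + c ∎)
  where open ≡-Reasoning

<ᵇ-irrefl : ∀ n → (n <ᵇ n) ≡ false
<ᵇ-irrefl zero    = refl
<ᵇ-irrefl (suc n) = <ᵇ-irrefl n

jumpMod-spec : ∀ {d} (a b : Fin d) → jumpMod d a b + toℕ a ≡ toℕ b + guard (toℕ b <ᵇ toℕ a) d
jumpMod-spec {d} a b = spec (toℕ a) (toℕ b) (toℕ<n a)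
  where
    spec : ∀ m n → m < d → (if m ≤ᵇ n then n ∸ m else d + n ∸ m) + m ≡ n + guard (n <ᵇ m) d
    spec m n m<d with m ≤ᵇ n | ≤ᵇ-reflects-≤ m n | n <ᵇ m | <ᵇ-reflects-< n m
    ... | true  | ofʸ m≤n | true  | ofʸ n<m = contradiction n<m (≤⇒≯ m≤n)
    ... | true  | ofʸ m≤n | false | _       = trans (m∸n+n≡m m≤n) (sym (+-identityʳ n))
    ... | false | ofⁿ m≰n | false | ofⁿ n≮m = contradiction (≮⇒≥ n≮m) m≰n
    ... | false | _       | true  | _       =
      trans (m∸n+n≡m (≤-trans (<⇒≤ m<d) (m≤m+n d n))) (+-comm d n)

jumpMod<d : ∀ {d} (a b : Fin d) → jumpMod d a b < d
jumpMod<d {d} a b with toℕ b <ᵇ toℕ a | <ᵇ-reflects-< (toℕ b) (toℕ a) | jumpMod-spec a b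
... | false | _       | eq = ≤-<-trans (m≤m+n _ (toℕ a))
                               (subst (_< d) (sym (trans eq (+-identityʳ _))) (toℕ<n b))
... | true  | ofʸ b<a | eq = +-cancelʳ-< (toℕ a) _ d
                               (subst (_< d + toℕ a) (sym (trans eq (+-comm (toℕ b) d)))
                                      (+-monoʳ-< d b<a))

jump-≽ : ∀ {d} (a b : Fin d) → jumpMod d a b + toℕ a ≽ toℕ b [mod d ]
jump-≽ {d} a b = guard (toℕ b <ᵇ toℕ a) 1 ,
  trans (jumpMod-spec a b) (cong (toℕ b +_) (guard-scale (toℕ b <ᵇ toℕ a) d))

sucMod-≽ : ∀ {d} {a b : Fin d} → sucMod a b → suc (toℕ a) ≽ toℕ b [mod d ]
sucMod-≽             (inj₁ a+1≡b)       = 0 , trans a+1≡b (sym (+-identityʳ _))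
sucMod-≽ {d} {b = b} (inj₂ (a+1≡d , b≡0)) =
  1 , trans a+1≡d (sym (trans (cong (_+ 1 * d) b≡0) (+-identityʳ d)))

nextIndex : ∀ {n} (i : Fin (suc n)) → ∃[ j ] sucMod i j
nextIndex {zero}  zero    = zero , inj₂ (refl , refl)
nextIndex {suc n} zero    = suc zero , inj₁ refl
nextIndex {suc n} (suc i) with nextIndex i
... | j , inj₁ i+1≡j          = suc j , inj₁ (cong suc i+1≡j)
... | _ , inj₂ (i+1≡n , _)    = zero , inj₂ (cong suc i+1≡n , refl)

both-maximal : ∀ {a b c} → a ≤ c → b ≤ c → a + b ≡ c + c → a ≡ c × b ≡ c
both-maximal a≤c b≤c eq with m≤n⇒m<n∨m≡n a≤c | m≤n⇒m<n∨m≡n b≤c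
... | inj₂ a≡c | inj₂ b≡c = a≡c , b≡c
... | inj₁ a<c | _        = contradiction eq (<⇒≢ (+-mono-<-≤ a<c b≤c))
... | inj₂ _   | inj₁ b<c = contradiction eq (<⇒≢ (+-mono-≤-< a≤c b<c))

twoResidues : ∀ {m j₁ j₂} → j₁ < 2 + m → j₂ < 2 + m → 2 + (j₁ + j₂) ≽ 0 [mod 2 + m ] →
              j₁ + j₂ ≡ m ⊎ (j₁ ≡ suc m × j₂ ≡ suc m)
twoResidues             _  _  (zero , ())
twoResidues {m}         _  _  (1 , eq) = inj₁ (trans (suc-injective (suc-injective eq)) (+-identityʳ m))
twoResidues {m}         j₁< j₂< (2 , eq) = inj₂ (both-maximal (s≤s⁻¹ j₁<) (s≤s⁻¹ j₂<) (begin
  _                         ≡⟨ suc-injective (suc-injective eq) ⟩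
  m + (2 + m + 0)           ≡⟨ solve (m ∷ []) ⟩
  suc m + suc m             ∎))
  where open ≡-Reasoning
twoResidues {m} {j₁} {j₂} j₁< j₂< (suc (suc (suc w)) , eq) = contradiction eq (<⇒≢ (begin-strict
  2 + (j₁ + j₂)             ≤⟨ +-monoʳ-≤ 2 (+-mono-≤ (s≤s⁻¹ j₁<) (s≤s⁻¹ j₂<)) ⟩
  2 + (suc m + suc m)       <⟨ m<m+n _ {2 + m + w * (2 + m)} (s≤s z≤n) ⟩
  2 + (suc m + suc m) + (2 + m + w * (2 + m)) ≡⟨ solve (m ∷ w ∷ []) ⟩
  (3 + w) * (2 + m)         ∎))
  where open ≤-Reasoning

module _ (G : PlaneGraph) where
  open ≡-Reasoning

  σ∘σ⁻¹ : ∀ x → σf G (σ⁻¹ G x) ≡ x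
  σ∘σ⁻¹ x = inverseʳ (σ G)

  σ⁻¹∘σ : ∀ x → σ⁻¹ G (σf G x) ≡ x
  σ⁻¹∘σ x = inverseˡ (σ G)

  vert-σ : ∀ x → vert G (σf G x) ≡ vert G x
  vert-σ x = sym (Equivalence.from (vert-orbit G x (σf G x)) (1 , refl))

  face-ψ : ∀ x → face G (ψ G x) ≡ face G x
  face-ψ x = sym (Equivalence.from (face-orbit G x (ψ G x)) (1 , refl))

  face-σ⁻¹ : ∀ x → face G (σ⁻¹ G x) ≡ face G (αf G x)
  face-σ⁻¹ x = trans (sym (face-ψ (σ⁻¹ G x))) (cong (face G ∘ αf G) (σ∘σ⁻¹ x))

  orbitInCycle : ∀ {n} (x : Fin (suc n) → Arc G) → (∀ i j → sucMod i j → ψ G (x i) ≡ x j) →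
                 ∀ m → ∃[ i ] iter (ψ G) m (x zero) ≡ x i
  orbitInCycle x next zero    = zero , refl
  orbitInCycle x next (suc m) with orbitInCycle x next m
  ... | i , reached with nextIndex i
  ... | j , i→j = j , trans (cong (ψ G) reached) (next i j i→j)

  externalVertex : ∀ {n} (u : Fin (suc n) → Fin (V G)) → ExternalCycle (suc n) G u →
                   ∀ v → External G v → ∃[ i ] v ≡ u i
  externalVertex u (_ , x , onOuter , next) v (y , vy≡v , fy≡outer)
    with Equivalence.to (face-orbit G (x zero) y) (trans (proj₂ (onOuter zero)) (sym fy≡outer))
  ... | m , walk with orbitInCycle x next m
  ... | i , reached = i , (begin
    v          ≡⟨ vy≡v ⟨
    vert G y   ≡⟨ cong (vert G) (trans (sym walk) reached) ⟩
    vert G (x i) ≡⟨ proj₁ (onOuter i) ⟩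
    u i        ∎)

  cycleVertex-external : ∀ {d} (u : Fin d → Fin (V G)) → ExternalCycle d G u →
                         ∀ i → External G (u i)
  cycleVertex-external u (_ , x , onOuter , _) i = x i , onOuter i

module _ {d : ℕ} (G : PlaneGraph) (L : Arc G → Fin d) where
  open ≡-Reasoning

  descentAt : Fin (V G) → Arc G → Bool
  descentAt v y = atVertex G v y ∧ (toℕ (L (σf G y)) <ᵇ toℕ (L y))

  vertexJumps : ∀ v → sumWhere (atVertex G v) (jump d G L) ≡ d * countWhere (descentAt v)
  vertexJumps v = begin
    sumWhere B (jump d G L)   ≡⟨ sumWhere-∑ B (jump d G L) ⟩
    jumps                     ≡⟨ +-cancelʳ-≡ colours jumps wraps (trans telescope (+-comm colours wraps)) ⟩
    wraps                     ≡⟨ descents ⟩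
    d * countWhere (descentAt v) ∎
    where
      B : Arc G → Bool
      B = atVertex G v
      jumpAt colour previous wrap : Arc G → ℕ
      jumpAt x   = guard (B x) (jump d G L x)
      colour x   = guard (B x) (toℕ (L x))
      previous x = guard (B x) (toℕ (L (σ⁻¹ G x)))
      wrap x     = guard (B x) (guard (toℕ (L x) <ᵇ toℕ (L (σ⁻¹ G x))) d)
      jumps colours wraps : ℕ
      jumps   = ∑[ x < 2 * E G ] jumpAt x
      colours = ∑[ x < 2 * E G ] colour x
      wraps   = ∑[ x < 2 * E G ] wrap x

      -- σ permutes the arcs at v, so the preceding colours are the colours
      rotate : ∑[ x < 2 * E G ] previous x ≡ colours
      rotate = trans (∑-permute previous (σ G)) (sum-cong-≗ λ y →
        cong₂ guard (cong (λ w → does (w ≟ v)) (vert-σ G y)) (cong (toℕ ∘ L) (σ⁻¹∘σ G y)))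

      step : ∀ x → jumpAt x + previous x ≡ colour x + wrap x
      step x with B x
      ... | true  = jumpMod-spec (L (σ⁻¹ G x)) (L x)
      ... | false = refl

      telescope : jumps + colours ≡ colours + wraps
      telescope = begin
        jumps + colours                          ≡⟨ cong (jumps +_) rotate ⟨
        jumps + ∑[ x < 2 * E G ] previous x      ≡⟨ ∑-distrib-+ jumpAt previous ⟨
        ∑[ x < 2 * E G ] (jumpAt x + previous x) ≡⟨ sum-cong-≗ step ⟩
        ∑[ x < 2 * E G ] (colour x + wrap x)     ≡⟨ ∑-distrib-+ colour wrap ⟩
        colours + wraps                          ∎

      -- reindexed by σ, a wrap-around is exactly a descent
      descents : wraps ≡ d * countWhere (descentAt v)
      descents = begin
        wraps                                          ≡⟨ ∑-permute wrap (σ G) ⟩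
        ∑[ y < 2 * E G ] wrap (σf G y)                 ≡⟨ sum-cong-≗ wrap-descent ⟩
        ∑[ y < 2 * E G ] (d * guard (descentAt v y) 1) ≡⟨ *-distribˡ-sum d (λ y → guard (descentAt v y) 1) ⟨
        d * ∑[ y < 2 * E G ] guard (descentAt v y) 1   ≡⟨ cong (d *_) (sumWhere-∑ (descentAt v) (λ _ → 1)) ⟨
        d * countWhere (descentAt v)                   ∎
        where
          wrap-descent : ∀ y → wrap (σf G y) ≡ d * guard (descentAt v y) 1
          wrap-descent y = trans
            (cong₂ (λ b z → guard b (guard (toℕ (L (σf G y)) <ᵇ toℕ (L z)) d))
                   (cong (λ w → does (w ≟ v)) (vert-σ G y)) (σ⁻¹∘σ G y))
            (guard-guard (B y) (toℕ (L (σf G y)) <ᵇ toℕ (L y)) d)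

  constantColour-noDescent : ∀ v (c : Fin d) → (∀ y → vert G y ≡ v → L y ≡ c) →
                             countWhere (descentAt v) ≡ 0
  constantColour-noDescent v c constant = trans (sumWhere-∑ (descentAt v) (λ _ → 1)) (∑-zero flat)
    where
      flat : ∀ y → guard (descentAt v y) 1 ≡ 0
      flat y with vert G y ≟ v
      ... | no  _  = refl
      ... | yes at rewrite constant (σf G y) (trans (vert-σ G y) at) | constant y at
                         | <ᵇ-irrefl (toℕ c) = refl

  module _ (faceRule : ∀ y → face G y ≢ outer G → sucMod (L (αf G (σf G y))) (L y)) where

    -- Rule (i) read at c(x): the next corner clockwise around the internal face
    -- of c(x) is c(σ⁻¹ (α x)), whose colour is one more.
    nextCorner : ∀ x → face G x ≢ outer G → sucMod (L x) (L (σ⁻¹ G (αf G x)))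
    nextCorner x internal =
      subst (λ z → sucMod (L z) (L (σ⁻¹ G (αf G x))))
            (trans (cong (αf G) (σ∘σ⁻¹ G (αf G x))) (α-invol G x))
            (faceRule (σ⁻¹ G (αf G x)) (internal ∘ trans sameFace))
      where
        sameFace : face G x ≡ face G (σ⁻¹ G (αf G x))
        sameFace = sym (trans (face-σ⁻¹ G (αf G x)) (cong (face G) (α-invol G x)))

    edgeJumps : ∀ x → InternalEdge G x → 2 + (jump d G L x + jump d G L (αf G x)) ≽ 0 [mod d ]
    edgeJumps x (internal₁ , internal₂) =
      ≽-cancelʳ (a + b + (a′ + b′))
        (subst (_≽ a + b + (a′ + b′) [mod d ]) (rearrange j₁ j₂ a b a′ b′)
               (≽-+ (≽-+ (jump-≽ (L (σ⁻¹ G x)) (L x)) (jump-≽ (L (σ⁻¹ G (αf G x))) (L (αf G x))))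
                    (≽-+ (sucMod-≽ (nextCorner x internal₁)) afterα)))
      where
        j₁ j₂ a b a′ b′ : ℕ
        j₁ = jump d G L x
        j₂ = jump d G L (αf G x)
        a  = toℕ (L x)
        b  = toℕ (L (αf G x))
        a′ = toℕ (L (σ⁻¹ G (αf G x)))
        b′ = toℕ (L (σ⁻¹ G x))
        afterα : suc b ≽ b′ [mod d ]
        afterα = subst (λ z → suc b ≽ toℕ (L (σ⁻¹ G z)) [mod d ]) (α-invol G x)
                       (sucMod-≽ (nextCorner (αf G x) internal₂))
        rearrange : ∀ j₁ j₂ a b a′ b′ →
                    j₁ + b′ + (j₂ + a′) + (suc a + suc b) ≡ 2 + (j₁ + j₂) + (a + b + (a′ + b′))
        rearrange = solve-∀

eulerCount : ∀ s J V F E → J + (2 + s) * (2 + s) ≡ V * (2 + s) → F * (2 + s) ≡ 2 * E →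
             V + F ≡ E + 2 → (J + J) + s * ((2 + s) + (2 + s)) ≡ 2 * E * s
eulerCount s J V F E vertices faces euler = +-cancelʳ-≡ T _ _ (begin
  J + J + s * ((2 + s) + (2 + s)) + (2 * ((2 + s) * (2 + s)) + 2 * (F * (2 + s)))
       ≡⟨ solve (s ∷ J ∷ F ∷ []) ⟩
  2 * (J + (2 + s) * (2 + s)) + 2 * (F * (2 + s)) + s * ((2 + s) + (2 + s))
       ≡⟨ cong (λ t → 2 * t + 2 * (F * (2 + s)) + s * ((2 + s) + (2 + s))) vertices ⟩
  2 * (V * (2 + s)) + 2 * (F * (2 + s)) + s * ((2 + s) + (2 + s)) ≡⟨ solve (s ∷ V ∷ F ∷ []) ⟩
  2 * ((V + F) * (2 + s)) + s * ((2 + s) + (2 + s))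
       ≡⟨ cong (λ t → 2 * (t * (2 + s)) + s * ((2 + s) + (2 + s))) euler ⟩
  2 * ((E + 2) * (2 + s)) + s * ((2 + s) + (2 + s))            ≡⟨ solve (s ∷ E ∷ []) ⟩
  2 * E * s + (2 * ((2 + s) * (2 + s)) + 2 * (2 * E))          ≡⟨ cong (λ t → 2 * E * s + (2 * ((2 + s) * (2 + s)) + 2 * t)) faces ⟨
  2 * E * s + (2 * ((2 + s) * (2 + s)) + 2 * (F * (2 + s)))    ∎)
  where
    T : ℕ
    T = 2 * ((2 + s) * (2 + s)) + 2 * (F * (2 + s))
    open ≡-Reasoning

module Count (k : ℕ) (G : PlaneGraph) (ang : IsAngulation (3 + k) G)
             (u : Fin (3 + k) → Fin (V G)) (cyc : ExternalCycle (3 + k) G u)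
             (L : Arc G → Fin (3 + k)) (lab : IsClockwiseLabelling (3 + k) G u L) where
  open ≡-Reasoning

  d s N : ℕ
  d = 3 + k
  s = suc k        -- d - 2
  N = 2 * E G

  faceRule : ∀ y → face G y ≢ outer G → sucMod (L (αf G (σf G y))) (L y)
  faceRule = proj₁ lab
  cycleColour : ∀ i y → vert G y ≡ u i → L y ≡ i
  cycleColour = proj₁ (proj₂ (proj₂ lab))
  oneDescent : ∀ v → Internal G v → countWhere (descentAt G L v) ≡ 1
  oneDescent = proj₂ (proj₂ (proj₂ lab))

  jp : Arc G → ℕ
  jp = jump d G L

  onOuter : Arc G → ℕ
  onOuter x = guard (inFace G (outer G) x) 1

  internalSum : ∀ v → Internal G v → sumWhere (atVertex G v) jp ≡ d
  internalSum v internal = begin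
    _                       ≡⟨ vertexJumps G L v ⟩
    d * countWhere (descentAt G L v) ≡⟨ cong (d *_) (oneDescent v internal) ⟩
    d * 1                   ≡⟨ *-identityʳ d ⟩
    d                       ∎

  externalSum : ∀ v → External G v → sumWhere (atVertex G v) jp ≡ 0
  externalSum v external with externalVertex G u cyc v external
  ... | i , refl = begin
    _                       ≡⟨ vertexJumps G L (u i) ⟩
    d * countWhere (descentAt G L (u i)) ≡⟨ cong (d *_) (constantColour-noDescent G L (u i) i
                                                  (cycleColour i)) ⟩
    d * 0                   ≡⟨ *-zeroʳ d ⟩
    0                       ∎

  vertexBalance : ∀ v → sumWhere (atVertex G v) jp + d * countWhere (λ i → does (u i ≟ v)) ≡ d
  vertexBalance v with any? (λ i → u i ≟ v)
  ... | yes (i , refl) = begin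
    _         ≡⟨ cong₂ (λ p q → p + d * q) (externalSum (u i) (cycleVertex-external G u cyc i))
                                           (fibre-injective u (proj₁ cyc) i) ⟩
    d * 1     ≡⟨ *-identityʳ d ⟩
    d         ∎
  ... | no none = begin
    _         ≡⟨ cong₂ (λ p q → p + d * q) (internalSum v internal) (fibre-empty u v none) ⟩
    d + d * 0 ≡⟨ cong (d +_) (*-zeroʳ d) ⟩
    d + 0     ≡⟨ +-identityʳ d ⟩
    d         ∎
    where
      internal : Internal G v
      internal external with externalVertex G u cyc v external
      ... | i , v≡uᵢ = none (i , sym v≡uᵢ)

  -- the jumps total d·(V - d): every vertex gives d, the d external ones give 0
  jumpTotal : ∑[ x < N ] jp x + d * d ≡ V G * d
  jumpTotal = begin
    ∑[ x < N ] jp x + d * d                      ≡⟨ cong₂ _+_ (∑-fibres (vert G) jp) (cong (d *_) positions) ⟩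
    ∑[ v < V G ] cv v + d * ∑[ v < V G ] cu v    ≡⟨ cong (∑[ v < V G ] cv v +_) (*-distribˡ-sum d cu) ⟩
    ∑[ v < V G ] cv v + ∑[ v < V G ] (d * cu v)  ≡⟨ ∑-distrib-+ cv (λ v → d * cu v) ⟨
    ∑[ v < V G ] (cv v + d * cu v)               ≡⟨ sum-cong-≗ vertexBalance ⟩
    ∑[ v < V G ] d                               ≡⟨ ∑-const (V G) d ⟩
    V G * d                                      ∎
    where
      cv cu : Fin (V G) → ℕ
      cv v = sumWhere (atVertex G v) jp
      cu v = countWhere (λ i → does (u i ≟ v))
      positions : d ≡ ∑[ v < V G ] cu v
      positions = trans (sym (trans (∑-const d 1) (*-identityʳ d))) (∑-fibres u (λ _ → 1))

  -- each of the F faces has d corners, one per arc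
  faceTotal : F G * d ≡ N
  faceTotal = begin
    F G * d                   ≡⟨ ∑-const (F G) d ⟨
    ∑[ f < F G ] d            ≡⟨ sum-cong-≗ (sym ∘ ang) ⟩
    ∑[ f < F G ] degree G f   ≡⟨ ∑-fibres (face G) (λ _ → 1) ⟨
    ∑[ x < N ] 1              ≡⟨ ∑-const N 1 ⟩
    N * 1                     ≡⟨ *-identityʳ N ⟩
    N                         ∎

  edgeCases : ∀ x → InternalEdge G x →
              jp x + jp (αf G x) ≡ s ⊎ (jp x ≡ suc s × jp (αf G x) ≡ suc s)
  edgeCases x internalEdge =
    twoResidues (jumpMod<d (L (σ⁻¹ G x)) (L x)) (jumpMod<d (L (σ⁻¹ G (αf G x))) (L (αf G x)))
                (edgeJumps G L faceRule x internalEdge)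

  arcTerm : Arc G → ℕ
  arcTerm x = jp x + jp (αf G x) + s * (onOuter x + onOuter (αf G x))

  arcTotal : ∑[ x < N ] arcTerm x ≡ N * s
  arcTotal = begin
    ∑[ x < N ] arcTerm x
        ≡⟨ ∑-distrib-+ (λ x → jp x + jp (αf G x)) (λ x → s * (onOuter x + onOuter (αf G x))) ⟩
    ∑[ x < N ] (jp x + jp (αf G x)) + ∑[ x < N ] (s * (onOuter x + onOuter (αf G x)))
        ≡⟨ cong₂ _+_ pairs corrections ⟩
    (J + J) + s * (d + d) ≡⟨ eulerCount s J (V G) (F G) (E G) jumpTotal faceTotal (euler G) ⟩
    N * s                 ∎
    where
      J : ℕ
      J = ∑[ x < N ] jp x
      pairs : ∑[ x < N ] (jp x + jp (αf G x)) ≡ J + J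
      pairs = trans (∑-distrib-+ jp (jp ∘ αf G)) (cong (J +_) (sym (∑-permute jp (α G))))
      outerDegree : ∑[ x < N ] onOuter x ≡ d
      outerDegree = trans (sym (sumWhere-∑ (inFace G (outer G)) (λ _ → 1))) (ang (outer G))
      corrections : ∑[ x < N ] (s * (onOuter x + onOuter (αf G x))) ≡ s * (d + d)
      corrections = trans (sym (*-distribˡ-sum s (λ x → onOuter x + onOuter (αf G x))))
        (cong (s *_) (trans (∑-distrib-+ onOuter (onOuter ∘ αf G))
          (cong₂ _+_ outerDegree (trans (sym (∑-permute onOuter (α G))) outerDegree))))

  -- every arc term is at least s: its edge is internal or it meets the external face
  arcLower : ∀ x → s ≤ arcTerm x
  arcLower x with face G x ≟ outer G | face G (αf G x) ≟ outer G
  ... | yes _      | _          = ≤-trans (m≤m*n s (suc _)) (m≤n+m _ _)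
  ... | no _       | yes _      = ≤-trans (m≤m*n s 1) (m≤n+m _ _)
  ... | no internal₁ | no internal₂ =
    ≤-trans (edgeLower (edgeCases x (internal₁ , internal₂))) (m≤m+n _ _)
    where
      edgeLower : ∀ {j₁ j₂} → j₁ + j₂ ≡ s ⊎ (j₁ ≡ suc s × j₂ ≡ suc s) → s ≤ j₁ + j₂
      edgeLower (inj₁ sum≡s)         = ≤-reflexive (sym sum≡s)
      edgeLower (inj₂ (refl , refl)) = ≤-trans (n≤1+n s) (m≤m+n (suc s) (suc s))

  -- an edge with both jumps d - 1 would push the total above N·s
  noDoubleJump : ∀ x → ¬ (jp x ≡ suc s × jp (αf G x) ≡ suc s)
  noDoubleJump x (first , second) =
    m+1+n≰m (N * s) (≤-trans (∑-excess arcTerm x arcLower peak) (≤-reflexive arcTotal))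
    where
      peak : s + d ≤ arcTerm x
      peak = ≤-trans (≤-reflexive (trans (+-suc s (suc s)) (cong₂ _+_ (sym first) (sym second))))
                     (m≤m+n _ _)

  edgeSum : ∀ x → InternalEdge G x → jp x + jp (αf G x) ≡ s
  edgeSum x internalEdge = resolve (edgeCases x internalEdge)
    where
      resolve : jp x + jp (αf G x) ≡ s ⊎ (jp x ≡ suc s × jp (αf G x) ≡ suc s) →
                jp x + jp (αf G x) ≡ s
      resolve (inj₁ sum≡s)  = sum≡s
      resolve (inj₂ double) = contradiction double (noDoubleJump x)

lemma3p3 : (d : ℕ) → 3 ≤ d → (G : PlaneGraph) → IsAngulation d G →
    (u : Fin d → Fin (V G)) → ExternalCycle d G u →
    (L : Arc G → Fin d) → IsClockwiseLabelling d G u L →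
    ((v : Fin (V G)) → (Internal G v → sumWhere (atVertex G v) (jump d G L) ≡ d)
                     × (External G v → sumWhere (atVertex G v) (jump d G L) ≡ 0))
    × ((x : Arc G) → InternalEdge G x → jump d G L x + jump d G L (αf G x) ≡ d ∸ 2)
lemma3p3 (suc (suc (suc k))) (s≤s (s≤s (s≤s _))) G ang u cyc L lab =
  (λ v → internalSum v , externalSum v) , edgeSum
  where open Count k G ang u cyc L lab
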